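{- For each of the triplets $(e,e,e)$, $(e,e,12)$, $(e,e,13)$, $(e,e,23)$, $(e,13,e)$, $(e,13,13)$, $(e,13,23)$, $(e,132,e)$, $(e,132,12)$, $(e,132,13)$, $(e,132,23)$, the minimal terms of the TRIP-Stern tree lie on the right-most path: for every $n\ge0$, the minimum $b_n=\min_{|v|=n}\min_i b_i(v)$ is attained as an entry of $(1,1,1)F_1^n$.
   Context: Let $A_0=\begin{pmatrix}0&0&1\\1&0&0\\0&1&1\end{pmatrix}$, $A_1=\begin{pmatrix}1&0&1\\0&1&0\\0&0&1\end{pmatrix}$. Elements of $S_3$ are identified with permutation matrices: $e=I$, $(12)=\begin{pmatrix}0&1&0\\1&0&0\\0&0&1\end{pmatrix}$, $(13)=\begin{pmatrix}0&0&1\\0&1&0\\1&0&0\end{pmatrix}$, $(23)=\begin{pmatrix}1&0&0\\0&0&1\\0&1&0\end{pmatrix}$, $(123)=\begin{pmatrix}0&1&0\\0&0&1\\1&0&0\end{pmatrix}$, $(132)=\begin{pmatrix}0&0&1\\1&0&0\\0&1&0\end{pmatrix}$. For $(\sigma,\tau_0,\tau_1)\in S_3^3$ put $F_0=\sigma A_0\tau_0$, $F_1=\sigma A_1\tau_1$. For $v=(i_1,\dots,i_n)\in\{0,1\}^n$ let $\triangle(v)=(1,1,1)F_{i_1}\cdots F_{i_n}=(b_1(v),b_2(v),b_3(v))$; level $n$ of the TRIP-Stern tree consists of the $\triangle(v)$ with $|v|=n$, and the right-most node of level $n$ is $(1,1,1)F_1^n$. -}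

module Defs where

open import Data.Nat using (ℕ; zero; suc; _+_; _*_)
open import Data.Fin using (Fin; zero; suc)
open import Data.Vec using (Vec; []; _∷_)
open import Data.Bool using (Bool; true; false)
open import Data.List using (List; []; _∷_)
open import Data.Product using (_×_; _,_)

Mat : Set
Mat = Fin 3 → Fin 3 → ℕ

Row : Set
Row = Fin 3 → ℕ

sum3 : (Fin 3 → ℕ) → ℕ
sum3 f = f zero + (f (suc zero) + f (suc (suc zero)))

_⊗_ : Mat → Mat → Mat
(A ⊗ B) i k = sum3 (λ j → A i j * B j k)

_·_ : Row → Mat → Row
(r · A) k = sum3 (λ j → r j * A j k)

mat : ℕ → ℕ → ℕ → ℕ → ℕ → ℕ → ℕ → ℕ → ℕ → Mat
mat a b c d e f g h i zero zero = a
mat a b c d e f g h i zero (suc zero) = b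
mat a b c d e f g h i zero (suc (suc zero)) = c
mat a b c d e f g h i (suc zero) zero = d
mat a b c d e f g h i (suc zero) (suc zero) = e
mat a b c d e f g h i (suc zero) (suc (suc zero)) = f
mat a b c d e f g h i (suc (suc zero)) zero = g
mat a b c d e f g h i (suc (suc zero)) (suc zero) = h
mat a b c d e f g h i (suc (suc zero)) (suc (suc zero)) = i

A₀ A₁ : Mat
A₀ = mat 0 0 1
         1 0 0
         0 1 1
A₁ = mat 1 0 1
         0 1 0
         0 0 1

data S3 : Set where
  e p12 p13 p23 p123 p132 : S3

perm : S3 → Mat
perm e    = mat 1 0 0  0 1 0  0 0 1
perm p12  = mat 0 1 0  1 0 0  0 0 1
perm p13  = mat 0 0 1  0 1 0  1 0 0
perm p23  = mat 1 0 0  0 0 1  0 1 0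
perm p123 = mat 0 1 0  0 0 1  1 0 0
perm p132 = mat 0 0 1  1 0 0  0 1 0

Triple : Set
Triple = S3 × S3 × S3

F : Triple → Bool → Mat
F (σ , τ₀ , τ₁) false = (perm σ ⊗ A₀) ⊗ perm τ₀
F (σ , τ₀ , τ₁) true  = (perm σ ⊗ A₁) ⊗ perm τ₁

ones : Row
ones _ = 1

nodeFrom : Triple → {n : ℕ} → Row → Vec Bool n → Row
nodeFrom t r [] = r
nodeFrom t r (b ∷ v) = nodeFrom t (r · F t b) v

node : Triple → {n : ℕ} → Vec Bool n → Row
node t v = nodeFrom t ones v

rightmost : (n : ℕ) → Vec Bool n
rightmost zero = []
rightmost (suc n) = true ∷ rightmost n

goodTriples : List Triple
goodTriples =
  (e , e , e) ∷ (e , e , p12) ∷ (e , e , p13) ∷ (e , e , p23) ∷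
  (e , p13 , e) ∷ (e , p13 , p13) ∷ (e , p13 , p23) ∷
  (e , p132 , e) ∷ (e , p132 , p12) ∷ (e , p132 , p13) ∷ (e , p132 , p23) ∷ []

-- Every column of A₀, A₁ and of a permutation matrix has a nonzero entry, and this
-- property is closed under products; hence every F t b maps positive rows to
-- positive rows and every entry of the tree is at least 1.  For the eleven
-- triplets σ = e, and some columns i, j (possibly i = j) of A₁ τ₁ are the standard
-- basis columns eⱼ, eᵢ, so the i-th and j-th entries of (1,1,1) F₁ⁿ stay equal to 1.
module Submission where

open import Defs
import Data.Nat as ℕ
open import Data.Nat using (ℕ; _+_; _*_; _≤_; _≤?_)
open import Data.Nat.Properties using (≤-refl; ≤-trans; ≤-reflexive; m≤m+n; m≤n+m; *-mono-≤; *-identityʳ; *-zeroʳ; +-identityʳ)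
open import Data.Fin using (Fin; zero; suc)
import Data.Fin as Fin
open import Data.Fin.Properties using (all?; any?)
open import Data.Vec using (Vec; []; _∷_)
open import Data.Bool using (Bool; true; false; if_then_else_)
open import Data.Product using (Σ; _×_; _,_)
open import Data.List.Relation.Unary.All using (All; []; _∷_; lookup)
open import Data.List.Membership.Propositional using (_∈_)
open import Relation.Nullary.Decidable using (Dec; True; toWitness; ⌊_⌋; _×-dec_)
open import Relation.Binary.PropositionalEquality using (_≡_; refl; cong; cong₂; trans)

sum3-positive : (f : Fin 3 → ℕ) (j : Fin 3) → 1 ≤ f j → 1 ≤ sum3 f
sum3-positive f zero p = ≤-trans p (m≤m+n _ _)
sum3-positive f (suc zero) p = ≤-trans p (≤-trans (m≤m+n _ _) (m≤n+m _ (f zero)))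
sum3-positive f (suc (suc zero)) p = ≤-trans p (≤-trans (m≤n+m _ (f (suc zero))) (m≤n+m _ (f zero)))

sum3-cong : {f g : Fin 3 → ℕ} → (∀ i → f i ≡ g i) → sum3 f ≡ sum3 g
sum3-cong eq = cong₂ _+_ (eq zero) (cong₂ _+_ (eq (suc zero)) (eq (suc (suc zero))))

Positive : Row → Set
Positive r = ∀ k → 1 ≤ r k

ColumnsPositive : Mat → Set
ColumnsPositive M = ∀ k → Σ (Fin 3) λ j → 1 ≤ M j k

columnsPositive? : (M : Mat) → Dec (ColumnsPositive M)
columnsPositive? M = all? λ k → any? λ j → 1 ≤? M j k

columnsPositive : (M : Mat) → {True (columnsPositive? M)} → ColumnsPositive M
columnsPositive M {p} = toWitness p

⊗-columnsPositive : {A B : Mat} → ColumnsPositive A → ColumnsPositive B → ColumnsPositive (A ⊗ B)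
⊗-columnsPositive {A} {B} cpA cpB k with cpB k
... | j , 1≤Bjk with cpA j
...   | i , 1≤Aij = i , sum3-positive (λ l → A i l * B l k) j (*-mono-≤ 1≤Aij 1≤Bjk)

·-positive : {r : Row} {M : Mat} → Positive r → ColumnsPositive M → Positive (r · M)
·-positive {r} {M} pos cp k with cp k
... | j , 1≤Mjk = sum3-positive (λ l → r l * M l k) j (*-mono-≤ (pos j) 1≤Mjk)

perm-columnsPositive : (σ : S3) → ColumnsPositive (perm σ)
perm-columnsPositive e    = columnsPositive (perm e)
perm-columnsPositive p12  = columnsPositive (perm p12)
perm-columnsPositive p13  = columnsPositive (perm p13)
perm-columnsPositive p23  = columnsPositive (perm p23)
perm-columnsPositive p123 = columnsPositive (perm p123)
perm-columnsPositive p132 = columnsPositive (perm p132)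

F-columnsPositive : (t : Triple) (b : Bool) → ColumnsPositive (F t b)
F-columnsPositive (σ , τ₀ , τ₁) false =
  ⊗-columnsPositive (⊗-columnsPositive (perm-columnsPositive σ) (columnsPositive A₀)) (perm-columnsPositive τ₀)
F-columnsPositive (σ , τ₀ , τ₁) true =
  ⊗-columnsPositive (⊗-columnsPositive (perm-columnsPositive σ) (columnsPositive A₁)) (perm-columnsPositive τ₁)

nodeFrom-positive : (t : Triple) {n : ℕ} {r : Row} (v : Vec Bool n) → Positive r → Positive (nodeFrom t r v)
nodeFrom-positive t [] pos = pos
nodeFrom-positive t (b ∷ v) pos = nodeFrom-positive t v (·-positive pos (F-columnsPositive t b))

δ : Fin 3 → Fin 3 → ℕ
δ i j = if ⌊ i Fin.≟ j ⌋ then 1 else 0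

UnitColumn : Mat → Fin 3 → Fin 3 → Set
UnitColumn M k j = ∀ i → M i k ≡ δ i j

sum3-δ : (r : Row) (j : Fin 3) → sum3 (λ i → r i * δ i j) ≡ r j
sum3-δ r zero
  rewrite *-identityʳ (r zero) | *-zeroʳ (r (suc zero)) | *-zeroʳ (r (suc (suc zero))) = +-identityʳ (r zero)
sum3-δ r (suc zero)
  rewrite *-zeroʳ (r zero) | *-identityʳ (r (suc zero)) | *-zeroʳ (r (suc (suc zero))) = +-identityʳ (r (suc zero))
sum3-δ r (suc (suc zero))
  rewrite *-zeroʳ (r zero) | *-zeroʳ (r (suc zero)) | *-identityʳ (r (suc (suc zero))) = refl

·-unitColumn : (r : Row) (M : Mat) {k j : Fin 3} → UnitColumn M k j → (r · M) k ≡ r j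
·-unitColumn r M {j = j} unit = trans (sum3-cong (λ i → cong (r i *_) (unit i))) (sum3-δ r j)

unitColumn? : (M : Mat) (k j : Fin 3) → Dec (UnitColumn M k j)
unitColumn? M k j = all? λ i → M i k ℕ.≟ δ i j

UnitColumnPair : Mat → Set
UnitColumnPair M = Σ (Fin 3) λ i → Σ (Fin 3) λ j → UnitColumn M i j × UnitColumn M j i

unitColumnPair : {M : Mat} (i j : Fin 3) →
  {True (unitColumn? M i j ×-dec unitColumn? M j i)} → UnitColumnPair M
unitColumnPair i j {p} = i , j , toWitness p

nodeFrom-rightmost-unit : (t : Triple) (n : ℕ) {r : Row} {i j : Fin 3} →
  UnitColumn (F t true) i j → UnitColumn (F t true) j i →
  r i ≡ 1 → r j ≡ 1 → nodeFrom t r (rightmost n) i ≡ 1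
nodeFrom-rightmost-unit t ℕ.zero _ _ rᵢ≡1 _ = rᵢ≡1
nodeFrom-rightmost-unit t (ℕ.suc n) {r} colᵢ colⱼ rᵢ≡1 rⱼ≡1 =
  nodeFrom-rightmost-unit t n colᵢ colⱼ
    (trans (·-unitColumn r (F t true) colᵢ) rⱼ≡1) (trans (·-unitColumn r (F t true) colⱼ) rᵢ≡1)

goodTriples-unitColumnPair : All (λ t → UnitColumnPair (F t true)) goodTriples
goodTriples-unitColumnPair =
  unitColumnPair zero zero ∷ unitColumnPair zero (suc zero) ∷ unitColumnPair (suc zero) (suc zero) ∷
  unitColumnPair zero zero ∷
  unitColumnPair zero zero ∷ unitColumnPair (suc zero) (suc zero) ∷ unitColumnPair zero zero ∷
  unitColumnPair zero zero ∷ unitColumnPair zero (suc zero) ∷ unitColumnPair (suc zero) (suc zero) ∷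
  unitColumnPair zero zero ∷ []

theorem17 : (t : Triple) → t ∈ goodTriples → (n : ℕ) →
    Σ (Fin 3) (λ i → (v : Vec Bool n) → (j : Fin 3) →
      node t (rightmost n) i ≤ node t v j)
theorem17 t t∈good n with lookup goodTriples-unitColumnPair t∈good
... | i , j , colᵢ , colⱼ = i , λ v k →
  ≤-trans (≤-reflexive (nodeFrom-rightmost-unit t n colᵢ colⱼ refl refl))
          (nodeFrom-positive t v (λ _ → ≤-refl) k)
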